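{- The finite projective plane $\Omega^D$ of order $9$ (the dual plane of $\Omega$) is not a Poncelet plane.
   Context: Miniquaternion near-field $\mathfrak{S}=\{0,\pm1,\pm i,\pm j,\pm k\}$: additively $\{a+bi: a,b\in GF(3)\}$ with $j:=1+i$, $k:=1-i$; multiplication on nonzero elements is the quaternion group ($i^2=j^2=k^2=-1$, $ij=k=-ji$, $jk=i=-kj$, $ki=j=-ik$, $-1$ central), $0$ absorbing. The plane $\Omega$ has points $(x,y)$ ($x,y\in\mathfrak{S}$), $(1,\mu,0)$ ($\mu\in\mathfrak{S}$), $(0,1,0)$; lines: $y=x\mu+\nu$ (the points $(x,y)$ with $y=x\mu+\nu$ and $(1,\mu,0)$), $x=\lambda$ (the points $(\lambda,y)$ and $(0,1,0)$), and the ideal line (all $(1,\mu,0)$ and $(0,1,0)$). $\Omega^D$ is the dual plane of $\Omega$: its points are the lines of $\Omega$, its lines are the points of $\Omega$, with the same incidence. An oval in a plane of order $n$ is a set of $n+1$ points no three collinear; secants/tangents of an oval are lines meeting it in two/exactly one point. For an ordered pair of ovals $(O_t,O_s)$, an $m$-sided Poncelet polygon ($3\le m\le n+1$) is a cyclically ordered $m$-tuple of distinct points of $O_s$ with every line joining cyclically consecutive vertices a tangent of $O_t$. $(O_t,O_s)$ is a Poncelet $m$-pair if an $m$-sided Poncelet polygon exists but no $m'$-sided one for $m'\neq m$, $3\le m'\le n+1$; a Poncelet $0$-pair if no secant of $O_s$ is a tangent of $O_t$; a Poncelet $\infty$-pair if some secant of $O_s$ is tangent to $O_t$ but no Poncelet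 polygon exists. A Poncelet plane is one in which every pair of ovals is a Poncelet $m$-pair ($3\le m\le n+1$), a Poncelet $0$-pair or a Poncelet $\infty$-pair. -}

module Defs where

open import Data.Nat using (ℕ; zero; suc; _≤_; _≡ᵇ_)
open import Data.Nat.DivMod using (_mod_)
open import Data.Fin using (Fin; toℕ)
open import Data.Bool using (Bool; true; false; if_then_else_; _∧_)
open import Data.List using (List; length)
open import Data.List.Membership.Propositional using (_∈_)
open import Data.List.Relation.Unary.Unique.Propositional using (Unique)
open import Data.Product using (Σ; ∃; _×_)
open import Data.Sum using (_⊎_)
open import Relation.Nullary using (¬_)
open import Relation.Binary.PropositionalEquality using (_≡_; _≢_)
open import Function.Definitions using (Injective)

data F3 : Set where
  f0 f1 f2 : F3

_+₃_ : F3 → F3 → F3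
f0 +₃ b = b
f1 +₃ f0 = f1
f1 +₃ f1 = f2
f1 +₃ f2 = f0
f2 +₃ f0 = f2
f2 +₃ f1 = f0
f2 +₃ f2 = f1

-- The miniquaternion near-field S = {0, ±1, ±i, ±j, ±k}

data Sign : Set where
  pos neg : Sign

data Unit : Set where
  u1 ui uj uk : Unit

data S : Set where
  𝟘 : S
  el : Sign → Unit → S

_·ₛ_ : Sign → Sign → Sign
pos ·ₛ s = s
neg ·ₛ pos = neg
neg ·ₛ neg = pos

unitMul : Unit → Unit → Sign × Unit
unitMul u1 u = pos Data.Product., u
unitMul u u1 = pos Data.Product., u
unitMul ui ui = neg Data.Product., u1
unitMul uj uj = neg Data.Product., u1
unitMul uk uk = neg Data.Product., u1
unitMul ui uj = pos Data.Product., uk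
unitMul uj ui = neg Data.Product., uk
unitMul uj uk = pos Data.Product., ui
unitMul uk uj = neg Data.Product., ui
unitMul uk ui = pos Data.Product., uj
unitMul ui uk = neg Data.Product., uj

_*_ : S → S → S
𝟘 * _ = 𝟘
el _ _ * 𝟘 = 𝟘
el s u * el t v = el ((s ·ₛ t) ·ₛ Data.Product.proj₁ (unitMul u v)) (Data.Product.proj₂ (unitMul u v))

-- additive structure: a + b i with a, b ∈ GF(3); j = 1 + i, k = 1 - i
negF : F3 → F3
negF f0 = f0
negF f1 = f2
negF f2 = f1

toPair : S → F3 × F3
toPair 𝟘 = f0 Data.Product., f0
toPair (el pos u1) = f1 Data.Product., f0
toPair (el pos ui) = f0 Data.Product., f1
toPair (el pos uj) = f1 Data.Product., f1
toPair (el pos uk) = f1 Data.Product., f2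
toPair (el neg u1) = f2 Data.Product., f0
toPair (el neg ui) = f0 Data.Product., f2
toPair (el neg uj) = f2 Data.Product., f2
toPair (el neg uk) = f2 Data.Product., f1

fromPair : F3 → F3 → S
fromPair f0 f0 = 𝟘
fromPair f1 f0 = el pos u1
fromPair f2 f0 = el neg u1
fromPair f0 f1 = el pos ui
fromPair f0 f2 = el neg ui
fromPair f1 f1 = el pos uj
fromPair f2 f2 = el neg uj
fromPair f1 f2 = el pos uk
fromPair f2 f1 = el neg uk

_+_ : S → S → S
x + y = fromPair (Data.Product.proj₁ (toPair x) +₃ Data.Product.proj₁ (toPair y))
                 (Data.Product.proj₂ (toPair x) +₃ Data.Product.proj₂ (toPair y))

infixl 6 _+_
infixl 7 _*_

code : S → ℕ
code 𝟘 = 0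
code (el pos u1) = 1
code (el pos ui) = 2
code (el pos uj) = 3
code (el pos uk) = 4
code (el neg u1) = 5
code (el neg ui) = 6
code (el neg uj) = 7
code (el neg uk) = 8

_==_ : S → S → Bool
x == y = code x ≡ᵇ code y

data ΩPt : Set where
  aff   : S → S → ΩPt
  ideal : S → ΩPt          -- (1 , μ , 0)
  vinf  : ΩPt              -- (0 , 1 , 0)

data ΩLn : Set where
  slope : S → S → ΩLn
  vert  : S → ΩLn
  linf  : ΩLn

ΩInc : ΩPt → ΩLn → Bool
ΩInc (aff x y) (slope μ ν) = y == (x * μ + ν)
ΩInc (ideal μ') (slope μ ν) = μ' == μ
ΩInc vinf (slope μ ν) = false
ΩInc (aff x y) (vert λ₀) = x == λ₀
ΩInc (ideal _) (vert _) = false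
ΩInc vinf (vert _) = true
ΩInc (aff _ _) linf = false
ΩInc (ideal _) linf = true
ΩInc vinf linf = true

record Plane : Set₁ where
  field
    Pt    : Set
    Ln    : Set
    inc   : Pt → Ln → Bool
    order : ℕ

Ω : Plane
Ω = record { Pt = ΩPt ; Ln = ΩLn ; inc = ΩInc ; order = 9 }

dual : Plane → Plane
dual P = record { Pt = Plane.Ln P ; Ln = Plane.Pt P
                ; inc = λ l p → Plane.inc P p l ; order = Plane.order P }

ΩD : Plane
ΩD = dual Ω

module _ (P : Plane) where
  open Plane P

  On : Pt → Ln → Set
  On p l = inc p l ≡ true

  meet : List Pt → Ln → ℕ
  meet List.[] l = 0
  meet (p List.∷ ps) l = if inc p l then suc (meet ps l) else meet ps l

  record Oval : Set where
    field
      pts      : List Pt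
      distinct : Unique pts
      size     : length pts ≡ suc order
      noThree  : ∀ {p q r} → p ∈ pts → q ∈ pts → r ∈ pts →
                 p ≢ q → q ≢ r → p ≢ r →
                 ¬ (Σ Ln λ l → On p l × On q l × On r l)

  Tangent : Oval → Ln → Set
  Tangent O l = meet (Oval.pts O) l ≡ 1

  Secant : Oval → Ln → Set
  Secant O l = meet (Oval.pts O) l ≡ 2

  next : ∀ {m} → Fin m → Fin m
  next {suc k} i = suc (toℕ i) mod suc k

  record PonceletPolygon (Ot Os : Oval) (m : ℕ) : Set where
    field
      vertex   : Fin m → Pt
      injective : Injective _≡_ _≡_ vertex
      onOs     : ∀ i → vertex i ∈ Oval.pts Os
      sides    : ∀ i → Σ Ln λ l → On (vertex i) l × On (vertex (next i)) l × Tangent Ot l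

  InRange : ℕ → Set
  InRange m = 3 ≤ m × m ≤ suc order

  PonceletMPair : Oval → Oval → ℕ → Set
  PonceletMPair Ot Os m =
    InRange m × PonceletPolygon Ot Os m ×
    (∀ m' → InRange m' → m' ≢ m → ¬ PonceletPolygon Ot Os m')

  Poncelet0Pair : Oval → Oval → Set
  Poncelet0Pair Ot Os = ∀ l → Secant Os l → ¬ Tangent Ot l

  PonceletInfPair : Oval → Oval → Set
  PonceletInfPair Ot Os =
    (Σ Ln λ l → Secant Os l × Tangent Ot l) ×
    (∀ m' → InRange m' → ¬ PonceletPolygon Ot Os m')

  PonceletPlane : Set
  PonceletPlane = ∀ (Ot Os : Oval) →
    (Σ ℕ λ m → PonceletMPair Ot Os m) ⊎ Poncelet0Pair Ot Os ⊎ PonceletInfPair Ot Os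

-- A Poncelet m-pair admits Poncelet polygons of one size only, and any Poncelet polygon
-- has a side that is a secant of the outer oval and a tangent of the inner one, so the pair
-- is neither a 0-pair nor an ∞-pair.  Hence a single pair of ovals carrying both a Poncelet
-- triangle and a Poncelet quadrilateral shows that a plane is not Poncelet.  In Ω^D such a
-- pair exists, and every incidence fact about it is certified by running decision
-- procedures over the 91 lines of Ω^D, i.e. the points of Ω.
module Submission where

open import Defs
open import Relation.Nullary using (¬_)
open import Data.Nat using (ℕ; zero; suc; _≤_; _≤?_; z≤n; s≤s)
  renaming (_≟_ to _≟ℕ_)
open import Data.Nat.Properties using (≤-antisym; <⇒≱)
open import Data.Fin using (zero; suc)
import Data.Fin.Properties as Fin
open import Data.Bool using (true; false)
  renaming (_≟_ to _≟𝔹_)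
open import Data.List using (List; []; _∷_; _++_; length; lookup; filter; map; cartesianProductWith)
open import Data.List.Relation.Unary.Any as Any using (here; there)
open import Data.List.Relation.Unary.All as All using (All; _∷_)
open import Data.List.Relation.Unary.AllPairs using (_∷_)
open import Data.List.Relation.Unary.Unique.Propositional using (Unique)
open import Data.List.Relation.Unary.Unique.Propositional.Properties using (filter⁺)
open import Data.List.Membership.Propositional using (_∈_; lose)
open import Data.List.Membership.Propositional.Properties
  using (∈-filter⁺; ∈-filter⁻; ∈-lookup; ∈-map⁺; ∈-++⁺ˡ; ∈-++⁺ʳ; ∈-cartesianProductWith⁺)
open import Data.Product using (Σ; _×_; _,_; proj₁)
open import Data.Sum using (inj₁; inj₂)
open import Data.Empty using (⊥; ⊥-elim)
open import Function using (_∘_)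
open import Relation.Nullary using (Dec; yes; no)
open import Relation.Nullary.Decidable using (map′; from-yes; _×-dec_)
open import Relation.Unary using (Decidable)
open import Relation.Binary.Definitions using (DecidableEquality)
open import Relation.Binary.PropositionalEquality using (_≡_; _≢_; refl; sym; cong; cong₂; subst; module ≡-Reasoning)

module _ {a} {A : Set a} where

  NoThreeDistinct : List A → Set a
  NoThreeDistinct ys = ∀ {p q r} → p ∈ ys → q ∈ ys → r ∈ ys → p ≢ q → q ≢ r → p ≢ r → ⊥

  twoDistinct⇒2≤length : ∀ {ys} {p q : A} → p ∈ ys → q ∈ ys → p ≢ q → 2 ≤ length ys
  twoDistinct⇒2≤length {_ ∷ _ ∷ _} _ _ _ = s≤s (s≤s z≤n)
  twoDistinct⇒2≤length {_ ∷ []} (here refl) (here refl) p≢q = ⊥-elim (p≢q refl)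

  threeDistinct⇒3≤length : ∀ {ys} {p q r : A} → p ∈ ys → q ∈ ys → r ∈ ys →
                           p ≢ q → q ≢ r → p ≢ r → 3 ≤ length ys
  threeDistinct⇒3≤length {_ ∷ _ ∷ _ ∷ _} _ _ _ _ _ _ = s≤s (s≤s (s≤s z≤n))
  threeDistinct⇒3≤length (here refl) (here refl) _ p≢q _ _ = ⊥-elim (p≢q refl)
  threeDistinct⇒3≤length _ (here refl) (here refl) _ q≢r _ = ⊥-elim (q≢r refl)
  threeDistinct⇒3≤length (here refl) _ (here refl) _ _ p≢r = ⊥-elim (p≢r refl)
  threeDistinct⇒3≤length {_ ∷ _ ∷ []} (there (here refl)) (there (here refl)) _ p≢q _ _ = ⊥-elim (p≢q refl)
  threeDistinct⇒3≤length {_ ∷ _ ∷ []} _ (there (here refl)) (there (here refl)) _ q≢r _ = ⊥-elim (q≢r refl)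
  threeDistinct⇒3≤length {_ ∷ _ ∷ []} (there (here refl)) _ (there (here refl)) _ _ p≢r = ⊥-elim (p≢r refl)

  unique∧noThreeDistinct⇒length≤2 : ∀ {ys} → Unique ys → NoThreeDistinct ys → length ys ≤ 2
  unique∧noThreeDistinct⇒length≤2 {[]} _ _ = z≤n
  unique∧noThreeDistinct⇒length≤2 {_ ∷ []} _ _ = s≤s z≤n
  unique∧noThreeDistinct⇒length≤2 {_ ∷ _ ∷ []} _ _ = s≤s (s≤s z≤n)
  unique∧noThreeDistinct⇒length≤2 {_ ∷ _ ∷ _ ∷ _} ((p≢q ∷ p≢r ∷ _) ∷ (q≢r ∷ _) ∷ _) none =
    ⊥-elim (none (here refl) (there (here refl)) (there (there (here refl))) p≢q q≢r p≢r)

  lookup-injective : ∀ {ys : List A} {i j} → Unique ys → lookup ys i ≡ lookup ys j → i ≡ j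
  lookup-injective {_ ∷ _} {zero}  {zero}  _ _ = refl
  lookup-injective {_ ∷ _} {zero}  {suc j} (y∉ ∷ _) eq = ⊥-elim (All.lookup y∉ (∈-lookup j) eq)
  lookup-injective {_ ∷ _} {suc i} {zero}  (y∉ ∷ _) eq = ⊥-elim (All.lookup y∉ (∈-lookup i) (sym eq))
  lookup-injective {_ ∷ _} {suc i} {suc j} (_ ∷ u) eq = cong suc (lookup-injective u eq)

module _ (P : Plane) where
  open Plane P

  On? : ∀ l → Decidable (λ p → On P p l)
  On? l p = inc p l ≟𝔹 true

  pointsOn : List Pt → Ln → List Pt
  pointsOn xs l = filter (On? l) xs

  meet≡length-pointsOn : ∀ xs l → meet P xs l ≡ length (pointsOn xs l)
  meet≡length-pointsOn []       l = refl
  meet≡length-pointsOn (p ∷ xs) l with inc p l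
  ... | true  = cong suc (meet≡length-pointsOn xs l)
  ... | false = meet≡length-pointsOn xs l

  NoThreeCollinear : List Pt → Set
  NoThreeCollinear xs = ∀ {p q r} → p ∈ xs → q ∈ xs → r ∈ xs → p ≢ q → q ≢ r → p ≢ r →
                        ¬ (Σ Ln λ l → On P p l × On P q l × On P r l)

  meet≤2⇒noThreeCollinear : ∀ {xs} → (∀ l → meet P xs l ≤ 2) → NoThreeCollinear xs
  meet≤2⇒noThreeCollinear {xs} meet≤2 p∈ q∈ r∈ p≢q q≢r p≢r (l , p∈l , q∈l , r∈l) =
    <⇒≱ (threeDistinct⇒3≤length (onLine p∈ p∈l) (onLine q∈ q∈l) (onLine r∈ r∈l) p≢q q≢r p≢r)
        (subst (_≤ 2) (meet≡length-pointsOn xs l) (meet≤2 l))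
    where
    onLine : ∀ {p} → p ∈ xs → On P p l → p ∈ pointsOn xs l
    onLine = ∈-filter⁺ (On? l)

  noThreeCollinear⇒meet≤2 : ∀ {xs} → Unique xs → NoThreeCollinear xs → ∀ l → meet P xs l ≤ 2
  noThreeCollinear⇒meet≤2 {xs} unique noThree l =
    subst (_≤ 2) (sym (meet≡length-pointsOn xs l))
      (unique∧noThreeDistinct⇒length≤2 (filter⁺ (On? l) unique) noThreeOnLine)
    where
    noThreeOnLine : NoThreeDistinct (pointsOn xs l)
    noThreeOnLine p∈ q∈ r∈ p≢q q≢r p≢r
      with (p∈xs , p∈l) ← ∈-filter⁻ (On? l) p∈
         | (q∈xs , q∈l) ← ∈-filter⁻ (On? l) q∈
         | (r∈xs , r∈l) ← ∈-filter⁻ (On? l) r∈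
      = noThree p∈xs q∈xs r∈xs p≢q q≢r p≢r (l , p∈l , q∈l , r∈l)

  ovalOfMeet≤2 : (xs : List Pt) → Unique xs → length xs ≡ suc order →
                 (∀ l → meet P xs l ≤ 2) → Oval P
  ovalOfMeet≤2 xs unique size meet≤2 = record
    { pts = xs ; distinct = unique ; size = size ; noThree = meet≤2⇒noThreeCollinear meet≤2 }

  joiningLine-secant : (O : Oval P) → ∀ {p q l} → p ∈ Oval.pts O → q ∈ Oval.pts O → p ≢ q →
                       On P p l → On P q l → Secant P O l
  joiningLine-secant O {l = l} p∈ q∈ p≢q p∈l q∈l = ≤-antisym
    (noThreeCollinear⇒meet≤2 (Oval.distinct O) (Oval.noThree O) l)
    (subst (2 ≤_) (sym (meet≡length-pointsOn (Oval.pts O) l))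
      (twoDistinct⇒2≤length (∈-filter⁺ (On? l) p∈ p∈l) (∈-filter⁺ (On? l) q∈ q∈l) p≢q))

  TangentSide : Oval P → Pt → Pt → Set
  TangentSide Ot p q = Σ Ln λ l → On P p l × On P q l × Tangent P Ot l

  PolygonConditions : Oval P → Oval P → List Pt → Set
  PolygonConditions Ot Os vs = Unique vs × All (_∈ Oval.pts Os) vs ×
    (∀ i → TangentSide Ot (lookup vs i) (lookup vs (next P i)))

  polygonOfList : ∀ {Ot Os} vs → PolygonConditions Ot Os vs → PonceletPolygon P Ot Os (length vs)
  polygonOfList vs (unique , on-Os , sides) = record
    { vertex = lookup vs ; injective = lookup-injective unique
    ; onOs = λ i → All.lookup on-Os (∈-lookup i) ; sides = sides }

  polygon⇒tangentSecant : ∀ {Ot Os m} → 3 ≤ m → PonceletPolygon P Ot Os m →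
                          Σ Ln λ l → Secant P Os l × Tangent P Ot l
  polygon⇒tangentSecant {Os = Os} (s≤s (s≤s (s≤s _))) polygon
    with (l , v₀∈l , v₁∈l , tangent) ← PonceletPolygon.sides polygon zero =
    l , joiningLine-secant Os (onOs zero) (onOs (suc zero)) v₀≢v₁ v₀∈l v₁∈l , tangent
    where
    open PonceletPolygon polygon
    v₀≢v₁ : vertex zero ≢ vertex (suc zero)
    v₀≢v₁ eq with () ← injective eq

  twoPolygons⇒¬PonceletPlane : ∀ {Ot Os m m′} → InRange P m → InRange P m′ → m ≢ m′ →
                               PonceletPolygon P Ot Os m → PonceletPolygon P Ot Os m′ →
                               ¬ PonceletPlane P
  twoPolygons⇒¬PonceletPlane {Ot} {Os} {m} {m′} m-ok m′-ok m≢m′ polygon polygon′ poncelet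
    with poncelet Ot Os
  ... | inj₂ (inj₁ zeroPair)
    with (l , secant , tangent) ← polygon⇒tangentSecant (proj₁ m-ok) polygon
    = zeroPair l secant tangent
  ... | inj₂ (inj₂ (_ , noPolygon)) = noPolygon m m-ok polygon
  ... | inj₁ (n , _ , _ , onlyN) with m ≟ℕ n
  ...   | yes refl = onlyN m′ m′-ok (m≢m′ ∘ sym) polygon′
  ...   | no m≢n   = onlyN m m-ok m≢n polygon

decode : ℕ → S
decode 1 = el pos u1
decode 2 = el pos ui
decode 3 = el pos uj
decode 4 = el pos uk
decode 5 = el neg u1
decode 6 = el neg ui
decode 7 = el neg uj
decode 8 = el neg uk
decode _ = 𝟘

decode-code : ∀ x → decode (code x) ≡ x
decode-code 𝟘           = refl
decode-code (el pos u1) = refl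
decode-code (el pos ui) = refl
decode-code (el pos uj) = refl
decode-code (el pos uk) = refl
decode-code (el neg u1) = refl
decode-code (el neg ui) = refl
decode-code (el neg uj) = refl
decode-code (el neg uk) = refl

code-injective : ∀ {x y} → code x ≡ code y → x ≡ y
code-injective {x} {y} eq = begin
  x                ≡⟨ sym (decode-code x) ⟩
  decode (code x)  ≡⟨ cong decode eq ⟩
  decode (code y)  ≡⟨ decode-code y ⟩
  y                ∎
  where open ≡-Reasoning

_≟S_ : DecidableEquality S
x ≟S y = map′ code-injective (cong code) (code x ≟ℕ code y)

_≟ΩLn_ : DecidableEquality ΩLn
slope μ ν ≟ΩLn slope μ′ ν′ =
  map′ (λ (μ≡ , ν≡) → cong₂ slope μ≡ ν≡) (λ { refl → refl , refl }) (μ ≟S μ′ ×-dec ν ≟S ν′)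
vert λ₀ ≟ΩLn vert λ₀′ = map′ (cong vert) (λ { refl → refl }) (λ₀ ≟S λ₀′)
linf ≟ΩLn linf = yes refl
slope _ _ ≟ΩLn vert _    = no λ ()
slope _ _ ≟ΩLn linf      = no λ ()
vert _    ≟ΩLn slope _ _ = no λ ()
vert _    ≟ΩLn linf      = no λ ()
linf      ≟ΩLn slope _ _ = no λ ()
linf      ≟ΩLn vert _    = no λ ()

allSign : List Sign
allSign = pos ∷ neg ∷ []

allUnit : List Unit
allUnit = u1 ∷ ui ∷ uj ∷ uk ∷ []

allS : List S
allS = 𝟘 ∷ cartesianProductWith el allSign allUnit

allΩPt : List ΩPt
allΩPt = vinf ∷ map ideal allS ++ cartesianProductWith aff allS allS

∈allSign : ∀ s → s ∈ allSign
∈allSign pos = here refl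
∈allSign neg = there (here refl)

∈allUnit : ∀ u → u ∈ allUnit
∈allUnit u1 = here refl
∈allUnit ui = there (here refl)
∈allUnit uj = there (there (here refl))
∈allUnit uk = there (there (there (here refl)))

∈allS : ∀ x → x ∈ allS
∈allS 𝟘        = here refl
∈allS (el s u) = there (∈-cartesianProductWith⁺ el (∈allSign s) (∈allUnit u))

∈allΩPt : ∀ p → p ∈ allΩPt
∈allΩPt (aff x y) = there (∈-++⁺ʳ (map ideal allS) (∈-cartesianProductWith⁺ aff (∈allS x) (∈allS y)))
∈allΩPt (ideal μ) = there (∈-++⁺ˡ (∈-map⁺ ideal (∈allS μ)))
∈allΩPt vinf      = here refl

∀ΩPt? : ∀ {Q : ΩPt → Set} → Decidable Q → Dec (∀ p → Q p)
∀ΩPt? Q? = map′ (λ all p → All.lookup all (∈allΩPt p)) (λ ∀Q → All.tabulate (λ {p} _ → ∀Q p))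
                (All.all? Q? allΩPt)

∃ΩPt? : ∀ {Q : ΩPt → Set} → Decidable Q → Dec (Σ ΩPt Q)
∃ΩPt? Q? = map′ Any.satisfied (λ (p , q) → lose (∈allΩPt p) q) (Any.any? Q? allΩPt)

open import Data.List.Relation.Unary.Unique.DecPropositional _≟ΩLn_ using (unique?)
open import Data.List.Membership.DecPropositional _≟ΩLn_ using (_∈?_)

tangentSide? : ∀ O p q → Dec (TangentSide ΩD O p q)
tangentSide? O p q = ∃ΩPt? λ l → On? ΩD l p ×-dec On? ΩD l q ×-dec meet ΩD (Oval.pts O) l ≟ℕ 1

innerOval : Oval ΩD
innerOval = ovalOfMeet≤2 ΩD lines (from-yes (unique? lines)) refl
                         (from-yes (∀ΩPt? λ p → meet ΩD lines p ≤? 2))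
  where
  lines : List ΩLn
  lines = slope (el neg uk) (el pos u1) ∷ slope (el neg u1) 𝟘 ∷ slope 𝟘 (el pos uk)
        ∷ slope (el pos u1) 𝟘 ∷ slope (el pos uk) (el pos u1) ∷ slope (el neg uk) (el neg u1)
        ∷ vert (el neg u1) ∷ slope (el pos uk) (el neg u1) ∷ vert (el pos u1)
        ∷ slope 𝟘 (el neg uk) ∷ []

outerOval : Oval ΩD
outerOval = ovalOfMeet≤2 ΩD lines (from-yes (unique? lines)) refl
                         (from-yes (∀ΩPt? λ p → meet ΩD lines p ≤? 2))
  where
  lines : List ΩLn
  lines = slope (el pos u1) (el pos uj) ∷ slope (el pos u1) (el pos u1) ∷ slope (el neg u1) (el neg uj)
        ∷ slope (el pos uk) (el neg ui) ∷ slope (el neg ui) (el neg ui) ∷ slope (el neg uk) (el neg uj)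
        ∷ slope (el neg u1) (el pos uj) ∷ slope (el pos uk) 𝟘 ∷ slope (el pos ui) (el pos u1)
        ∷ slope (el neg uk) 𝟘 ∷ []

polygonConditions? : ∀ vs → Dec (PolygonConditions ΩD innerOval outerOval vs)
polygonConditions? vs = unique? vs ×-dec All.all? (_∈? Oval.pts outerOval) vs ×-dec
  Fin.all? (λ i → tangentSide? innerOval (lookup vs i) (lookup vs (next ΩD i)))

triangle : PonceletPolygon ΩD innerOval outerOval 3
triangle = polygonOfList ΩD vertices (from-yes (polygonConditions? vertices))
  where
  vertices : List ΩLn
  vertices = slope (el neg u1) (el neg uj) ∷ slope (el neg uk) 𝟘 ∷ slope (el neg u1) (el pos uj) ∷ []

quadrilateral : PonceletPolygon ΩD innerOval outerOval 4
quadrilateral = polygonOfList ΩD vertices (from-yes (polygonConditions? vertices))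
  where
  vertices : List ΩLn
  vertices = slope (el pos u1) (el pos uj) ∷ slope (el pos u1) (el pos u1)
           ∷ slope (el neg ui) (el neg ui) ∷ slope (el pos uk) 𝟘 ∷ []

theorem11 : ¬ PonceletPlane ΩD
theorem11 = twoPolygons⇒¬PonceletPlane ΩD 3-ok 4-ok (λ ()) triangle quadrilateral
  where
  3-ok : InRange ΩD 3
  3-ok = s≤s (s≤s (s≤s z≤n)) , s≤s (s≤s (s≤s z≤n))
  4-ok : InRange ΩD 4
  4-ok = s≤s (s≤s (s≤s z≤n)) , s≤s (s≤s (s≤s (s≤s z≤n)))
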